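{- Let $p$ be a prime such that $p\equiv 1\pmod 4$. Then $$\prod_{\substack{k=0\\ k\neq \frac{3p-3}{4}}}^{p-1}(3+4k)\equiv \prod_{\substack{k=0\\ k\neq \frac{p-1}{4}}}^{p-1}(1+4k)\pmod{p^2}.$$ -}

module Defs where

open import Data.Nat using (ℕ; zero; suc; _*_; _+_; _≡ᵇ_)
open import Data.Bool using (if_then_else_)

prodExcept : ℕ → ℕ → (ℕ → ℕ) → ℕ
prodExcept zero    j f = 1
prodExcept (suc n) j f = prodExcept n j f * (if n ≡ᵇ j then 1 else f n)

module Submission where

-- Let p = 4m + 1.  The left product runs over the numbers 3 + 4k (k ≤ 4m) except
-- 3p, the right one over the numbers 1 + 4k except p.  Cutting each range into four
-- blocks of m consecutive factors, the two sides match block-pair against block-pair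
-- thanks to one identity: if c + d = 2p then
--     (c + 2p)(d + 2p) = cd + 8p²  ≡  cd   (mod p²).
-- Pairing the i-th factor of one block with the (m-1-i)-th factor of the next one,
-- the third and fourth blocks on the left are congruent to the first two on the right
-- (with c = 1 + 4i), and the first two blocks on the left to the last two on the
-- right (with c = 3 + 4i).

open import Defs
open import Data.Nat using (ℕ; _+_; _*_; _∸_; _/_; _%_)
open import Data.Nat.Primality using (Prime)
open import Data.Integer using (+_; _-_)
open import Data.Integer.Divisibility using (_∣_)
open import Relation.Binary.PropositionalEquality using (_≡_)

open import Data.Bool using (true; false; if_then_else_)
open import Data.Nat using (zero; suc; _≡ᵇ_; _<_; _≤_)
import Data.Nat.Properties as ℕ
open import Data.Nat.DivMod using (m≡m%n+[m/n]*n; m*n/n≡m)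
import Data.Nat.Tactic.RingSolver as ℕ-Solver
import Data.Integer as ℤ
import Data.Integer.Properties as ℤ
import Data.Integer.Tactic.RingSolver as ℤ-Solver
open import Data.Integer.Divisibility.Signed
  using (divides; ∣⇒∣ᵤ; ∣m∣n⇒∣m+n; ∣m⇒∣m*n; ∣n⇒∣m*n; ∣m⇒∣-m)
  renaming (_∣_ to _∣ₛ_)
open import Relation.Binary.PropositionalEquality
  using (_≢_; refl; sym; trans; cong; cong₂; subst; subst₂; module ≡-Reasoning)
open import Relation.Nullary using (contradiction)

prod : ℕ → (ℕ → ℕ) → ℕ
prod zero    f = 1
prod (suc n) f = prod n f * f n

prod-split : ∀ a b g → prod (a + b) g ≡ prod a g * prod b (λ i → g (a + i))
prod-split a zero g =
  trans (cong (λ n → prod n g) (ℕ.+-identityʳ a)) (sym (ℕ.*-identityʳ _))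
prod-split a (suc b) g = begin
  prod (a + suc b) g                               ≡⟨ cong (λ n → prod n g) (ℕ.+-suc a b) ⟩
  prod (a + b) g * g (a + b)                       ≡⟨ cong (_* g (a + b)) (prod-split a b g) ⟩
  prod a g * prod b (λ i → g (a + i)) * g (a + b)  ≡⟨ ℕ.*-assoc (prod a g) _ _ ⟩
  prod a g * prod (suc b) (λ i → g (a + i))        ∎
  where open ≡-Reasoning

prod-front : ∀ n g → prod (suc n) g ≡ g 0 * prod n (λ i → g (suc i))
prod-front n g =
  trans (prod-split 1 n g) (cong (_* prod n (λ i → g (suc i))) (ℕ.*-identityˡ (g 0)))

prod-mul : ∀ n f g → prod n f * prod n g ≡ prod n (λ i → f i * g i)
prod-mul zero    f g = refl
prod-mul (suc n) f g =
  trans (interchange (prod n f) (prod n g) (f n) (g n)) (cong (_* (f n * g n)) (prod-mul n f g))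
  where
  interchange : ∀ a b c d → a * c * (b * d) ≡ a * b * (c * d)
  interchange = ℕ-Solver.solve-∀

prod-reverse : ∀ n f → prod n f ≡ prod n (λ i → f (n ∸ suc i))
prod-reverse zero    f = refl
prod-reverse (suc n) f = begin
  prod n f * f n                        ≡⟨ cong (_* f n) (prod-reverse n f) ⟩
  prod n (λ i → f (n ∸ suc i)) * f n    ≡⟨ ℕ.*-comm _ (f n) ⟩
  f n * prod n (λ i → f (n ∸ suc i))    ≡⟨ sym (prod-front n (λ i → f (n ∸ i))) ⟩
  prod (suc n) (λ i → f (suc n ∸ suc i)) ∎
  where open ≡-Reasoning

prod-thirds : ∀ m g →
  prod (3 * m) g ≡ prod m g * prod m (λ i → g (m + i)) * prod m (λ i → g (m + (m + i)))
prod-thirds m g = begin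
  prod (3 * m) g                                                   ≡⟨ cong (λ n → prod n g) (three m) ⟩
  prod (m + (m + m)) g                                             ≡⟨ prod-split m (m + m) g ⟩
  prod m g * prod (m + m) (λ i → g (m + i))                        ≡⟨ cong (prod m g *_) (prod-split m m _) ⟩
  prod m g * (prod m (λ i → g (m + i)) * prod m (λ i → g (m + (m + i)))) ≡⟨ ℕ.*-assoc (prod m g) _ _ ⟨
  prod m g * prod m (λ i → g (m + i)) * prod m (λ i → g (m + (m + i))) ∎
  where
  open ≡-Reasoning
  three : ∀ m → 3 * m ≡ m + (m + m)
  three = ℕ-Solver.solve-∀

factor-≢ : ∀ {k e} (f : ℕ → ℕ) → k ≢ e → (if k ≡ᵇ e then 1 else f k) ≡ f k
factor-≢ {k} {e} f k≢e with k ≡ᵇ e | ℕ.≡ᵇ⇒≡ k e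
... | true  | k≡e = contradiction (k≡e _) k≢e
... | false | _   = refl

factor-≡ : ∀ e (f : ℕ → ℕ) → (if e ≡ᵇ e then 1 else f e) ≡ 1
factor-≡ e f with e ≡ᵇ e | ℕ.≡⇒≡ᵇ e e refl
... | true | _ = refl

prodExcept-below : ∀ {e} (f : ℕ → ℕ) n → n ≤ e → prodExcept n e f ≡ prod n f
prodExcept-below f zero    _     = refl
prodExcept-below f (suc n) n<e =
  cong₂ _*_ (prodExcept-below f n (ℕ.<⇒≤ n<e)) (factor-≢ f (ℕ.<⇒≢ n<e))

prodExcept-split : ∀ e (f : ℕ → ℕ) r →
  prodExcept (r + suc e) e f ≡ prod e f * prod r (λ i → f (i + suc e))
prodExcept-split e f zero =
  cong₂ _*_ (prodExcept-below f e ℕ.≤-refl) (factor-≡ e f)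
prodExcept-split e f (suc r) = begin
  prodExcept (r + suc e) e f * (if r + suc e ≡ᵇ e then 1 else f (r + suc e))
    ≡⟨ cong₂ _*_ (prodExcept-split e f r) (factor-≢ f (ℕ.>⇒≢ (ℕ.m≤n+m (suc e) r))) ⟩
  prod e f * prod r (λ i → f (i + suc e)) * f (r + suc e)
    ≡⟨ ℕ.*-assoc (prod e f) _ _ ⟩
  prod e f * prod (suc r) (λ i → f (i + suc e)) ∎
  where open ≡-Reasoning

infix 4 _≡_[mod_]
record _≡_[mod_] (x y n : ℕ) : Set where
  constructor ≡mod
  field n∣x-y : + n ∣ₛ (+ x - + y)

≡mod-refl : ∀ {n} x → x ≡ x [mod n ]
≡mod-refl x = ≡mod (divides (+ 0) (ℤ.+-inverseʳ (+ x)))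

≡mod-sym : ∀ {n x y} → x ≡ y [mod n ] → y ≡ x [mod n ]
≡mod-sym {x = x} {y} (≡mod n∣x-y) =
  ≡mod (subst (_ ∣ₛ_) (negate-difference (+ x) (+ y)) (∣m⇒∣-m n∣x-y))
  where
  negate-difference : ∀ a b → ℤ.- (a - b) ≡ b - a
  negate-difference = ℤ-Solver.solve-∀

≡mod-multiple : ∀ {n} x k → x + k * n ≡ x [mod n ]
≡mod-multiple {n} x k = ≡mod (divides (+ k) (begin
  + (x + k * n) - + x       ≡⟨ cong (_- + x) (ℤ.pos-+ x (k * n)) ⟩
  + x ℤ.+ + (k * n) - + x   ≡⟨ cancel (+ x) (+ (k * n)) ⟩
  + (k * n)                 ≡⟨ ℤ.pos-* k n ⟩
  + k ℤ.* + n               ∎))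
  where
  open ≡-Reasoning
  cancel : ∀ a b → a ℤ.+ b - a ≡ b
  cancel = ℤ-Solver.solve-∀

≡mod-* : ∀ {n x y z w} → x ≡ y [mod n ] → z ≡ w [mod n ] → x * z ≡ y * w [mod n ]
≡mod-* {n} {x} {y} {z} {w} (≡mod n∣x-y) (≡mod n∣z-w) =
  ≡mod (subst (_ ∣ₛ_) (sym expand) (∣m∣n⇒∣m+n (∣m⇒∣m*n (+ z) n∣x-y) (∣n⇒∣m*n (+ y) n∣z-w)))
  where
  open ≡-Reasoning
  distribute : ∀ a b c d → a ℤ.* c - b ℤ.* d ≡ (a - b) ℤ.* c ℤ.+ b ℤ.* (c - d)
  distribute = ℤ-Solver.solve-∀
  expand : + (x * z) - + (y * w) ≡ (+ x - + y) ℤ.* + z ℤ.+ + y ℤ.* (+ z - + w)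
  expand = begin
    + (x * z) - + (y * w)      ≡⟨ cong₂ _-_ (ℤ.pos-* x z) (ℤ.pos-* y w) ⟩
    + x ℤ.* + z - + y ℤ.* + w  ≡⟨ distribute (+ x) (+ y) (+ z) (+ w) ⟩
    (+ x - + y) ℤ.* + z ℤ.+ + y ℤ.* (+ z - + w) ∎

≡mod-prod : ∀ {N} n f g → (∀ i → i < n → f i ≡ g i [mod N ]) → prod n f ≡ prod n g [mod N ]
≡mod-prod zero    f g fi≡gi = ≡mod-refl 1
≡mod-prod (suc n) f g fi≡gi =
  ≡mod-* (≡mod-prod n f g (λ i i<n → fi≡gi i (ℕ.m<n⇒m<1+n i<n))) (fi≡gi n ℕ.≤-refl)

shifted-pair : ∀ p c d → c + d ≡ 2 * p → (c + 2 * p) * (d + 2 * p) ≡ c * d + 8 * (p * p)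
shifted-pair p c d c+d≡2p = begin
  (c + 2 * p) * (d + 2 * p)               ≡⟨ expand c d (2 * p) ⟩
  c * d + (c + d) * (2 * p) + 2 * p * (2 * p) ≡⟨ cong (λ s → c * d + s * (2 * p) + 2 * p * (2 * p)) c+d≡2p ⟩
  c * d + 2 * p * (2 * p) + 2 * p * (2 * p) ≡⟨ collect (c * d) p ⟩
  c * d + 8 * (p * p)                     ∎
  where
  open ≡-Reasoning
  expand : ∀ c d n → (c + n) * (d + n) ≡ c * d + (c + d) * n + n * n
  expand = ℕ-Solver.solve-∀
  collect : ∀ a p → a + 2 * p * (2 * p) + 2 * p * (2 * p) ≡ a + 8 * (p * p)
  collect = ℕ-Solver.solve-∀

pair-congruence : ∀ p {a b} c d → a ≡ c + 2 * p → b ≡ d + 2 * p → c + d ≡ 2 * p →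
  a * b ≡ c * d [mod p * p ]
pair-congruence p c d refl refl c+d≡2p =
  subst (_≡ c * d [mod p * p ]) (sym (shifted-pair p c d c+d≡2p)) (≡mod-multiple (c * d) 8)

reflected-pairs : ∀ {N} m a b c d →
  (∀ i j → suc (i + j) ≡ m → a i * b j ≡ c i * d j [mod N ]) →
  prod m a * prod m b ≡ prod m c * prod m d [mod N ]
reflected-pairs m a b c d pair =
  subst₂ (_≡_[mod _ ]) (zip a b) (zip c d)
    (≡mod-prod m _ _ (λ i i<m → pair i (m ∸ suc i) (ℕ.m+[n∸m]≡n i<m)))
  where
  zip : ∀ f g → prod m (λ i → f i * g (m ∸ suc i)) ≡ prod m f * prod m g
  zip f g = sym (trans (cong (prod m f *_) (prod-reverse m g)) (prod-mul m f _))

t₃ t₁ : ℕ → ℕ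
t₃ k = 3 + 4 * k
t₁ k = 1 + 4 * k

-- With m = 1 + i + j and p = 4m + 1: the third and fourth left blocks against the
-- first two right blocks, with c = 1 + 4i and d = 1 + 4(m + 1 + j).
low-pairs : ∀ m i j → suc (i + j) ≡ m →
  t₃ (m + (m + i)) * t₃ (j + suc (3 * m)) ≡ t₁ i * t₁ (j + suc m) [mod suc (4 * m) * suc (4 * m) ]
low-pairs .(suc (i + j)) i j refl =
  pair-congruence (suc (4 * suc (i + j))) (t₁ i) (t₁ (j + suc (suc (i + j))))
    (shift-c i j) (shift-d i j) (sum i j)
  where
  shift-c : ∀ i j → let m = suc (i + j) in
    3 + 4 * (m + (m + i)) ≡ (1 + 4 * i) + 2 * suc (4 * m)
  shift-c = ℕ-Solver.solve-∀
  shift-d : ∀ i j → let m = suc (i + j) in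
    3 + 4 * (j + suc (3 * m)) ≡ (1 + 4 * (j + suc m)) + 2 * suc (4 * m)
  shift-d = ℕ-Solver.solve-∀
  sum : ∀ i j → let m = suc (i + j) in
    (1 + 4 * i) + (1 + 4 * (j + suc m)) ≡ 2 * suc (4 * m)
  sum = ℕ-Solver.solve-∀

-- The last two right blocks against the first two left blocks, with c = 3 + 4i
-- and d = 3 + 4(m + j).
high-pairs : ∀ m i j → suc (i + j) ≡ m →
  t₁ (m + i + suc m) * t₁ (m + (m + j) + suc m) ≡ t₃ i * t₃ (m + j) [mod suc (4 * m) * suc (4 * m) ]
high-pairs .(suc (i + j)) i j refl =
  pair-congruence (suc (4 * suc (i + j))) (t₃ i) (t₃ (suc (i + j) + j))
    (shift-c i j) (shift-d i j) (sum i j)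
  where
  shift-c : ∀ i j → let m = suc (i + j) in
    1 + 4 * (m + i + suc m) ≡ (3 + 4 * i) + 2 * suc (4 * m)
  shift-c = ℕ-Solver.solve-∀
  shift-d : ∀ i j → let m = suc (i + j) in
    1 + 4 * (m + (m + j) + suc m) ≡ (3 + 4 * (m + j)) + 2 * suc (4 * m)
  shift-d = ℕ-Solver.solve-∀
  sum : ∀ i j → let m = suc (i + j) in
    (3 + 4 * i) + (3 + 4 * (m + j)) ≡ 2 * suc (4 * m)
  sum = ℕ-Solver.solve-∀

congruence-4m+1 : ∀ m → let p = suc (4 * m) in
  prodExcept p (3 * m) t₃ ≡ prodExcept p m t₁ [mod p * p ]
congruence-4m+1 m =
  subst₂ (_≡_[mod suc (4 * m) * suc (4 * m) ]) (sym left-blocks) (sym right-blocks)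
    (≡mod-* (≡mod-sym (reflected-pairs m _ _ _ _ (high-pairs m)))
            (reflected-pairs m _ _ _ _ (low-pairs m)))
  where
  open ≡-Reasoning
  L₀ L₁ L₂ L₃ R₀ R₁ R₂ R₃ : ℕ
  L₀ = prod m t₃
  L₁ = prod m (λ i → t₃ (m + i))
  L₂ = prod m (λ i → t₃ (m + (m + i)))
  L₃ = prod m (λ i → t₃ (i + suc (3 * m)))
  R₀ = prod m t₁
  R₁ = prod m (λ i → t₁ (i + suc m))
  R₂ = prod m (λ i → t₁ (m + i + suc m))
  R₃ = prod m (λ i → t₁ (m + (m + i) + suc m))
  left-length : ∀ m → suc (4 * m) ≡ m + suc (3 * m)
  left-length = ℕ-Solver.solve-∀
  right-length : ∀ m → suc (4 * m) ≡ 3 * m + suc m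
  right-length = ℕ-Solver.solve-∀
  regroup : ∀ w x y z → w * (x * y * z) ≡ y * z * (w * x)
  regroup = ℕ-Solver.solve-∀
  left-blocks : prodExcept (suc (4 * m)) (3 * m) t₃ ≡ L₀ * L₁ * (L₂ * L₃)
  left-blocks = begin
    prodExcept (suc (4 * m)) (3 * m) t₃  ≡⟨ cong (λ n → prodExcept n (3 * m) t₃) (left-length m) ⟩
    prodExcept (m + suc (3 * m)) (3 * m) t₃ ≡⟨ prodExcept-split (3 * m) t₃ m ⟩
    prod (3 * m) t₃ * L₃                 ≡⟨ cong (_* L₃) (prod-thirds m t₃) ⟩
    L₀ * L₁ * L₂ * L₃                    ≡⟨ ℕ.*-assoc (L₀ * L₁) L₂ L₃ ⟩
    L₀ * L₁ * (L₂ * L₃)                  ∎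
  right-blocks : prodExcept (suc (4 * m)) m t₁ ≡ R₂ * R₃ * (R₀ * R₁)
  right-blocks = begin
    prodExcept (suc (4 * m)) m t₁        ≡⟨ cong (λ n → prodExcept n m t₁) (right-length m) ⟩
    prodExcept (3 * m + suc m) m t₁      ≡⟨ prodExcept-split m t₁ (3 * m) ⟩
    R₀ * prod (3 * m) (λ i → t₁ (i + suc m)) ≡⟨ cong (R₀ *_) (prod-thirds m (λ i → t₁ (i + suc m))) ⟩
    R₀ * (R₁ * R₂ * R₃)                  ≡⟨ regroup R₀ R₁ R₂ R₃ ⟩
    R₂ * R₃ * (R₀ * R₁)                  ∎

one-mod-four : ∀ p → p % 4 ≡ 1 → p ≡ suc (4 * (p / 4))
one-mod-four p p%4≡1 = trans (m≡m%n+[m/n]*n p 4) (cong₂ _+_ p%4≡1 (ℕ.*-comm (p / 4) 4))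

omitted-left : ∀ m → (3 * suc (4 * m) ∸ 3) / 4 ≡ 3 * m
omitted-left m = begin
  (3 * suc (4 * m) ∸ 3) / 4   ≡⟨ cong (λ n → (n ∸ 3) / 4) (expand m) ⟩
  (3 + 3 * m * 4 ∸ 3) / 4     ≡⟨ cong (_/ 4) (ℕ.m+n∸m≡n 3 (3 * m * 4)) ⟩
  3 * m * 4 / 4               ≡⟨ m*n/n≡m (3 * m) 4 ⟩
  3 * m                       ∎
  where
  open ≡-Reasoning
  expand : ∀ m → 3 * suc (4 * m) ≡ 3 + 3 * m * 4
  expand = ℕ-Solver.solve-∀

omitted-right : ∀ m → (suc (4 * m) ∸ 1) / 4 ≡ m
omitted-right m = trans (cong (_/ 4) (ℕ.*-comm 4 m)) (m*n/n≡m m 4)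

corollary2p2 : (p : ℕ) → Prime p → p % 4 ≡ 1 →
    (+ (p * p)) ∣ (+ prodExcept p ((3 * p ∸ 3) / 4) (λ k → 3 + 4 * k)
                   - + prodExcept p ((p ∸ 1) / 4) (λ k → 1 + 4 * k))
corollary2p2 p _ p%4≡1 = ∣⇒∣ᵤ (_≡_[mod_].n∣x-y (at-4m+1 p (p / 4) (one-mod-four p p%4≡1)))
  where
  at-4m+1 : ∀ p m → p ≡ suc (4 * m) →
    prodExcept p ((3 * p ∸ 3) / 4) t₃ ≡ prodExcept p ((p ∸ 1) / 4) t₁ [mod p * p ]
  at-4m+1 .(suc (4 * m)) m refl rewrite omitted-left m | omitted-right m = congruence-4m+1 m
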